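{- For all integers $s\geq 1$, $t\geq\max\{s,3\}$ and $c\geq 1$, there is a graph $G_s$ that does not contain $K_{s,t}$ as a minor such that every colouring of $G_s$ with $s$ colours has a monochromatic component with more than $c$ vertices.
   Context: All graphs are finite and simple. Colourings need not be proper; a monochromatic component is a connected component of the subgraph induced by the vertices of one colour. $K_{s,t}$ is the complete bipartite graph with parts of sizes $s$ and $t$. -}

module Defs where

open import Data.Nat using (ℕ; suc)
open import Data.Fin using (Fin)
open import Data.Bool using (Bool; true; false)
open import Data.Maybe using (Maybe; just)
open import Data.Sum using (_⊎_; inj₁; inj₂)
open import Data.Product using (Σ; ∃; _×_)
open import Function.Definitions using (Injective)
open import Relation.Binary.PropositionalEquality using (_≡_)
open import Relation.Binary.Construct.Closure.ReflexiveTransitive using (Star)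

record Graph : Set where
  field
    n      : ℕ
    adj    : Fin n → Fin n → Bool
    sym    : ∀ x y → adj x y ≡ adj y x
    irrefl : ∀ x → adj x x ≡ false

open Graph public

Edge : (G : Graph) → Fin (n G) → Fin (n G) → Set
Edge G x y = adj G x y ≡ true

InducedEdge : (G : Graph) → (Fin (n G) → Set) → Fin (n G) → Fin (n G) → Set
InducedEdge G P x y = P x × P y × Edge G x y

ConnectedIn : (G : Graph) → (Fin (n G) → Set) → Fin (n G) → Fin (n G) → Set
ConnectedIn G P x y = P x × P y × Star (InducedEdge G P) x y

-- A model of K_{s,t} as a minor of G: each vertex of G is assigned to at most
-- one branch set (indexed by the vertices Fin s ⊎ Fin t of K_{s,t}), so branch
-- sets are disjoint; each branch set is nonempty and induces a connected
-- subgraph; for each a : Fin s, b : Fin t some edge of G joins the branch sets.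
record KstMinorModel (G : Graph) (s t : ℕ) : Set where
  field
    branch    : Fin (n G) → Maybe (Fin s ⊎ Fin t)
    nonempty  : ∀ h → ∃ λ x → branch x ≡ just h
    connected : ∀ h x y → branch x ≡ just h → branch y ≡ just h →
                ConnectedIn G (λ z → branch z ≡ just h) x y
    adjacent  : ∀ (a : Fin s) (b : Fin t) → ∃ λ x → ∃ λ y →
                branch x ≡ just (inj₁ a) × branch y ≡ just (inj₂ b) × Edge G x y

HasKstMinor : Graph → ℕ → ℕ → Set
HasKstMinor G s t = KstMinorModel G s t

Colouring : Graph → ℕ → Set
Colouring G k = Fin (n G) → Fin k

InMonoComponent : (G : Graph) {k : ℕ} → Colouring G k → Fin (n G) → Fin (n G) → Set
InMonoComponent G f v w = ConnectedIn G (λ z → f z ≡ f v) v w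

HasMonoComponentLargerThan : (G : Graph) {k : ℕ} → Colouring G k → ℕ → Set
HasMonoComponentLargerThan G f c =
  ∃ λ v → Σ (Fin (suc c) → Fin (n G)) λ g →
    Injective _≡_ _≡_ g × (∀ i → InMonoComponent G f v (g i))

-- G₀ is a path on c + 1 vertices and Gₖ₊₁ is an apex joined to c disjoint copies of Gₖ.
-- Given a colouring of Gₖ₊₁ with k + 1 colours, either every copy contains a vertex of
-- the apex's colour, giving a monochromatic star on c + 1 vertices, or some copy avoids
-- that colour and is coloured with k colours, so induction applies.
-- Branch sets in a path are intervals, so each has at most one neighbouring branch set
-- on either side; this rules out K₁,₃, and in K₂,₂ every branch set would have a
-- neighbour to its left, an infinite descent.  Deleting the branch set containing the
-- apex (if any) from a K_{a,b} model in Gₖ₊₁ leaves a connected model inside one copy,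
-- so Gₖ has no K_{a,b} minor whenever a, b ≥ k + 1 and a + b ≥ k + 4.
module Submission where

open import Defs
open import Data.Nat using (ℕ; zero; suc; _+_; _*_; _≤_; _<_; z≤n; s≤s; s≤s⁻¹)
open import Data.Nat.Properties
  using (_≟_; ≤-refl; ≤-trans; ≤-antisym; ≤-reflexive; <⇒≤; ≤∧≢⇒<; ≰⇒>; n≤1+n;
         m≤n⇒m≤1+n; 1+n≢n; +-suc; +-comm; +-monoʳ-≤)
open import Data.Fin using (Fin; zero; suc; toℕ; inject≤; punchIn; punchOut; combine; remQuot)
  renaming (_<_ to _<ᶠ_)
open import Data.Fin.Properties
  using (toℕ-injective; suc-injective; toℕ-inject₁; inject≤-injective; punchIn-injective;
         punchInᵢ≢i; punchOut-injective; combine-injectiveˡ; combine-injectiveʳ;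
         remQuot-combine; combine-remQuot; any?; all?; ¬∀⟶∃¬)
  renaming (_≟_ to _≟ᶠ_)
open import Data.Fin.Induction using (<-wellFounded; <-weakInduction)
open import Data.Bool using (Bool; true; false; _∨_; _∧_)
open import Data.Bool.Properties using (∨-comm; ∧-zeroʳ)
open import Data.Maybe using (Maybe; just)
open import Data.Maybe.Properties using (just-injective)
open import Data.Sum using (_⊎_; inj₁; inj₂)
open import Data.Sum.Properties using (inj₁-injective; inj₂-injective)
open import Data.Product using (Σ; ∃; ∃₂; _×_; _,_; proj₁; proj₂)
open import Data.Empty using (⊥; ⊥-elim)
open import Function using (_∘_; id)
open import Function.Definitions using (Injective)
open import Induction.WellFounded using (Acc; acc)
open import Relation.Nullary using (¬_; Dec; yes; no; does)
open import Relation.Nullary.Decidable using (dec-true; dec-false)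
open import Relation.Binary.PropositionalEquality
  using (_≡_; _≢_; refl; trans; cong; cong₂; subst; subst₂)
  renaming (sym to ≡-sym)
open import Relation.Binary.Construct.Closure.ReflexiveTransitive using (Star; ε; _◅_; _◅◅_; gmap)

edge-sym : ∀ G {x y} → Edge G x y → Edge G y x
edge-sym G {x} {y} e = trans (Graph.sym G y x) e

Connected : (G : Graph) {L : Set} → (Fin (n G) → L) → L → Set
Connected G branch h =
  ∀ x y → branch x ≡ h → branch y ≡ h → Star (InducedEdge G (λ z → branch z ≡ h)) x y

-- A K_{a,b} model whose branch sets are the fibres of `branch` over the labels A i and B j.
-- Fibres over other labels are unconstrained, so deleting a branch set is a relabelling.
record Model (G : Graph) (L : Set) (a b : ℕ) : Set where
  field
    branch      : Fin (n G) → L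
    A           : Fin a → L
    B           : Fin b → L
    A-injective : Injective _≡_ _≡_ A
    B-injective : Injective _≡_ _≡_ B
    A≢B         : ∀ i j → A i ≢ B j
    connectedA  : ∀ i → Connected G branch (A i)
    connectedB  : ∀ j → Connected G branch (B j)
    adjacent    : ∀ i j → ∃₂ λ x y → branch x ≡ A i × branch y ≡ B j × Edge G x y

  InBranchSet : Fin (n G) → Set
  InBranchSet z = (∃ λ i → branch z ≡ A i) ⊎ (∃ λ j → branch z ≡ B j)

open Model

fromKstMinorModel : ∀ {G s t} → KstMinorModel G s t → Model G (Maybe (Fin s ⊎ Fin t)) s t
fromKstMinorModel M = record
  { branch      = KstMinorModel.branch M
  ; A           = just ∘ inj₁
  ; B           = just ∘ inj₂
  ; A-injective = inj₁-injective ∘ just-injective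
  ; B-injective = inj₂-injective ∘ just-injective
  ; A≢B         = λ _ _ ()
  ; connectedA  = λ i x y p q → proj₂ (proj₂ (connected (inj₁ i) x y p q))
  ; connectedB  = λ j x y p q → proj₂ (proj₂ (connected (inj₂ j) x y p q))
  ; adjacent    = KstMinorModel.adjacent M
  }
  where open KstMinorModel M using (connected)

restrict : ∀ {G L a b a′ b′} → Model G L a b →
           (f : Fin a′ → Fin a) → Injective _≡_ _≡_ f →
           (g : Fin b′ → Fin b) → Injective _≡_ _≡_ g → Model G L a′ b′
restrict M f f-inj g g-inj = record
  { branch      = branch M
  ; A           = A M ∘ f
  ; B           = B M ∘ g
  ; A-injective = f-inj ∘ A-injective M
  ; B-injective = g-inj ∘ B-injective M
  ; A≢B         = λ i j → A≢B M (f i) (g j)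
  ; connectedA  = connectedA M ∘ f
  ; connectedB  = connectedB M ∘ g
  ; adjacent    = λ i j → adjacent M (f i) (g j)
  }

shrink : ∀ {G L a b a′ b′} → Model G L a b → a′ ≤ a → b′ ≤ b → Model G L a′ b′
shrink M a′≤a b′≤b =
  restrict M (λ i → inject≤ i a′≤a) (inject≤-injective _ _ _ _)
             (λ j → inject≤ j b′≤b) (inject≤-injective _ _ _ _)

swapSides : ∀ {G L a b} → Model G L a b → Model G L b a
swapSides {G} M = record
  { branch      = branch M
  ; A           = B M
  ; B           = A M
  ; A-injective = B-injective M
  ; B-injective = A-injective M
  ; A≢B         = λ i j → A≢B M j i ∘ ≡-sym
  ; connectedA  = connectedB M
  ; connectedB  = connectedA M
  ; adjacent    = λ i j → flip (adjacent M j i)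
  }
  where
  flip : ∀ {h h′} → (∃₂ λ x y → branch M x ≡ h × branch M y ≡ h′ × Edge G x y) →
         ∃₂ λ y x → branch M y ≡ h′ × branch M x ≡ h × Edge G y x
  flip (x , y , px , py , e) = y , x , py , px , edge-sym G e

module _ {G H : Graph} (e : Fin (n G) → Fin (n H)) (e-injective : Injective _≡_ _≡_ e)
         (reflect : ∀ {u v} → Edge H (e u) (e v) → Edge G u v) where

  lift-walk : ∀ {P : Fin (n H) → Set} → (∀ {z} → P z → ∃ λ u → e u ≡ z) →
              ∀ {x y} → Star (InducedEdge H P) x y →
              ∀ {u v} → e u ≡ x → e v ≡ y → Star (InducedEdge G (P ∘ e)) u v
  lift-walk cover ε {u} refl eq = subst (Star _ u) (e-injective (≡-sym eq)) ε
  lift-walk cover ((Px , Px′ , edge) ◅ walk) refl eq with cover Px′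
  ... | u′ , refl = (Px , Px′ , reflect edge) ◅ lift-walk cover walk refl eq

  pullback : ∀ {L a b} (M : Model H L a b) → (∀ z → InBranchSet M z → ∃ λ u → e u ≡ z) →
             Model G L a b
  pullback M cover = record
    { branch      = branch M ∘ e
    ; A           = A M
    ; B           = B M
    ; A-injective = A-injective M
    ; B-injective = B-injective M
    ; A≢B         = A≢B M
    ; connectedA  = λ i u v p q →
        lift-walk (λ p → cover _ (inj₁ (i , p))) (connectedA M i (e u) (e v) p q) refl refl
    ; connectedB  = λ j u v p q →
        lift-walk (λ p → cover _ (inj₂ (j , p))) (connectedB M j (e u) (e v) p q) refl refl
    ; adjacent    = λ i j → pull-edge (adjacent M i j)
    }
    where
    pull-edge : ∀ {i j} → (∃₂ λ x y → branch M x ≡ A M i × branch M y ≡ B M j × Edge H x y) →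
                ∃₂ λ u v → branch M (e u) ≡ A M i × branch M (e v) ≡ B M j × Edge G u v
    pull-edge {i} {j} (x , y , px , py , edge)
      with cover x (inj₁ (i , px)) | cover y (inj₂ (j , py))
    ... | u , refl | v , refl = u , v , px , py , reflect edge

NoKabMinor : ℕ → Graph → Set₁
NoKabMinor r G = ∀ {L} a b → r ≤ a → r ≤ b → r + 3 ≤ a + b → ¬ Model G L a b

-- Paths

does-∨ : ∀ {P Q : Set} (p : Dec P) (q : Dec Q) → (does p ∨ does q) ≡ true → P ⊎ Q
does-∨ (yes p) _       _ = inj₁ p
does-∨ (no _)  (yes q) _ = inj₂ q
does-∨ (no _)  (no _)  ()

path : ℕ → Graph
path m = record
  { n      = m
  ; adj    = λ x y → does (suc (toℕ x) ≟ toℕ y) ∨ does (suc (toℕ y) ≟ toℕ x)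
  ; sym    = λ x y → ∨-comm (does (suc (toℕ x) ≟ toℕ y)) _
  ; irrefl = λ x → cong₂ _∨_ (dec-false (suc (toℕ x) ≟ toℕ x) 1+n≢n)
                             (dec-false (suc (toℕ x) ≟ toℕ x) 1+n≢n)
  }

Consecutive : ℕ → ℕ → Set
Consecutive i j = suc i ≡ j ⊎ suc j ≡ i

path-edge : ∀ {m} {x y : Fin m} → Edge (path m) x y → Consecutive (toℕ x) (toℕ y)
path-edge {x = x} {y} = does-∨ (suc (toℕ x) ≟ toℕ y) (suc (toℕ y) ≟ toℕ x)

path-edge⁻¹ : ∀ {m} {x y : Fin m} → suc (toℕ x) ≡ toℕ y → Edge (path m) x y
path-edge⁻¹ {x = x} {y} x→y =
  cong (_∨ does (suc (toℕ y) ≟ toℕ x)) (dec-true (suc (toℕ x) ≟ toℕ y) x→y)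

path-connected : ∀ {m} (P : Fin (suc m) → Set) → (∀ z → P z) →
                 ∀ x → Star (InducedEdge (path (suc m)) P) zero x
path-connected {m} P everywhere = <-weakInduction (Star (InducedEdge (path (suc m)) P) zero) ε
  λ i walk → walk ◅◅ ((everywhere _ , everywhere _ , path-edge⁻¹ (cong suc (toℕ-inject₁ i))) ◅ ε)

consecutive-≤ : ∀ {i j k} → i < k → Consecutive i j → j ≤ k
consecutive-≤ i<k (inj₁ refl) = i<k
consecutive-≤ i<k (inj₂ refl) = ≤-trans (n≤1+n _) (<⇒≤ i<k)

walk-passes : ∀ {m} {S : Fin m → Set} {x y k} → Star (InducedEdge (path m) S) x y → S x →
              toℕ x ≤ toℕ k → toℕ k ≤ toℕ y → S k
walk-passes {S = S} ε Sx x≤k k≤x = subst S (toℕ-injective (≤-antisym x≤k k≤x)) Sx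
walk-passes {S = S} {x = x} {k = k} ((_ , Sx′ , edge) ◅ walk) Sx x≤k k≤y with toℕ x ≟ toℕ k
... | yes x≡k = subst S (toℕ-injective x≡k) Sx
... | no x≢k  = walk-passes walk Sx′ (consecutive-≤ (≤∧≢⇒< x≤k x≢k) (path-edge edge)) k≤y

module Labelling {m} {L : Set} (branch : Fin m → L) where

  Convex : L → Set
  Convex h = ∀ {x y k} → branch x ≡ h → branch y ≡ h → toℕ x ≤ toℕ k → toℕ k ≤ toℕ y →
             branch k ≡ h

  connected⇒convex : ∀ {h} → Connected (path m) branch h → Convex h
  connected⇒convex conn px py = walk-passes (conn _ _ px py) px

  RightNeighbour : L → L → Set
  RightNeighbour h h′ = ∃₂ λ x y → branch x ≡ h × branch y ≡ h′ × suc (toℕ x) ≡ toℕ y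

  Neighbours : L → L → Set
  Neighbours h h′ = RightNeighbour h h′ ⊎ RightNeighbour h′ h

  edge⇒neighbours : ∀ {x y h h′} → branch x ≡ h → branch y ≡ h′ → Edge (path m) x y →
                    Neighbours h h′
  edge⇒neighbours px py edge with path-edge edge
  ... | inj₁ x→y = inj₁ (_ , _ , px , py , x→y)
  ... | inj₂ y→x = inj₂ (_ , _ , py , px , y→x)

  outside : ∀ {y h h′} → branch y ≡ h′ → h′ ≢ h → branch y ≢ h
  outside py h′≢h = h′≢h ∘ trans (≡-sym py)

  right-exit-> : ∀ {h x y z} → Convex h → branch x ≡ h → branch y ≢ h →
                 suc (toℕ x) ≡ toℕ y → branch z ≡ h → toℕ z < toℕ y
  right-exit-> convex px y∉h x→y pz =
    ≰⇒> λ y≤z → y∉h (convex px pz (subst (toℕ _ ≤_) x→y (n≤1+n _)) y≤z)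

  left-exit-< : ∀ {h x y z} → Convex h → branch x ≡ h → branch y ≢ h →
                suc (toℕ y) ≡ toℕ x → branch z ≡ h → toℕ y < toℕ z
  left-exit-< convex px y∉h y→x pz =
    ≰⇒> λ z≤y → y∉h (convex pz px z≤y (subst (toℕ _ ≤_) y→x (n≤1+n _)))

  rightNeighbour-unique : ∀ {h h₁ h₂} → Convex h → h₁ ≢ h → h₂ ≢ h →
                          RightNeighbour h h₁ → RightNeighbour h h₂ → h₁ ≡ h₂
  rightNeighbour-unique convex h₁≢h h₂≢h (x₁ , y₁ , p₁ , q₁ , s₁) (x₂ , y₂ , p₂ , q₂ , s₂) =
    trans (≡-sym q₁) (trans (cong branch (toℕ-injective (≤-antisym y₁≤y₂ y₂≤y₁))) q₂)
    where
    y₁≤y₂ : toℕ y₁ ≤ toℕ y₂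
    y₁≤y₂ = subst (_≤ toℕ y₂) s₁ (right-exit-> convex p₂ (outside q₂ h₂≢h) s₂ p₁)
    y₂≤y₁ : toℕ y₂ ≤ toℕ y₁
    y₂≤y₁ = subst (_≤ toℕ y₁) s₂ (right-exit-> convex p₁ (outside q₁ h₁≢h) s₁ p₂)

  leftNeighbour-unique : ∀ {h h₁ h₂} → Convex h → h₁ ≢ h → h₂ ≢ h →
                         RightNeighbour h₁ h → RightNeighbour h₂ h → h₁ ≡ h₂
  leftNeighbour-unique convex h₁≢h h₂≢h (x₁ , y₁ , p₁ , q₁ , s₁) (x₂ , y₂ , p₂ , q₂ , s₂) =
    trans (≡-sym p₁) (trans (cong branch (toℕ-injective (≤-antisym x₁≤x₂ x₂≤x₁))) p₂)
    where
    x₁≤x₂ : toℕ x₁ ≤ toℕ x₂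
    x₁≤x₂ = s≤s⁻¹ (subst (toℕ x₁ <_) (≡-sym s₂) (left-exit-< convex q₁ (outside p₁ h₁≢h) s₁ q₂))
    x₂≤x₁ : toℕ x₂ ≤ toℕ x₁
    x₂≤x₁ = s≤s⁻¹ (subst (toℕ x₂ <_) (≡-sym s₁) (left-exit-< convex q₂ (outside p₂ h₂≢h) s₂ q₁))

  at-most-two-neighbours : ∀ {h} → Convex h → (f : Fin 3 → L) → Injective _≡_ _≡_ f →
                           (∀ k → f k ≢ h) → (∀ k → Neighbours h (f k)) → ⊥
  at-most-two-neighbours {h} convex f f-inj f≢h nb =
    by-sides (nb zero) (nb (suc zero)) (nb (suc (suc zero)))
    where
    right : ∀ i j → i ≢ j → RightNeighbour h (f i) → RightNeighbour h (f j) → ⊥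
    right i j i≢j r r′ = i≢j (f-inj (rightNeighbour-unique convex (f≢h i) (f≢h j) r r′))
    left : ∀ i j → i ≢ j → RightNeighbour (f i) h → RightNeighbour (f j) h → ⊥
    left i j i≢j l l′ = i≢j (f-inj (leftNeighbour-unique convex (f≢h i) (f≢h j) l l′))
    by-sides : Neighbours h (f zero) → Neighbours h (f (suc zero)) →
               Neighbours h (f (suc (suc zero))) → ⊥
    by-sides (inj₁ r₀) (inj₁ r₁) _         = right zero (suc zero) (λ ()) r₀ r₁
    by-sides (inj₂ l₀) (inj₂ l₁) _         = left zero (suc zero) (λ ()) l₀ l₁
    by-sides (inj₁ r₀) (inj₂ _)  (inj₁ r₂) = right zero (suc (suc zero)) (λ ()) r₀ r₂
    by-sides (inj₁ _)  (inj₂ l₁) (inj₂ l₂) = left (suc zero) (suc (suc zero)) (λ ()) l₁ l₂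
    by-sides (inj₂ _)  (inj₁ r₁) (inj₁ r₂) = right (suc zero) (suc (suc zero)) (λ ()) r₁ r₂
    by-sides (inj₂ l₀) (inj₁ _)  (inj₂ l₂) = left zero (suc (suc zero)) (λ ()) l₀ l₂

  two-neighbours⇒leftNeighbour : ∀ {h} → Convex h → (f : Fin 2 → L) → Injective _≡_ _≡_ f →
                                 (∀ k → f k ≢ h) → (∀ k → Neighbours h (f k)) →
                                 ∃ λ k → RightNeighbour (f k) h
  two-neighbours⇒leftNeighbour convex f f-inj f≢h nb with nb zero | nb (suc zero)
  ... | inj₂ l₀ | _       = zero , l₀
  ... | inj₁ _  | inj₂ l₁ = suc zero , l₁
  ... | inj₁ r₀ | inj₁ r₁ =
    ⊥-elim (0≢1 (f-inj (rightNeighbour-unique convex (f≢h zero) (f≢h (suc zero)) r₀ r₁)))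
    where
    0≢1 : zero ≢ suc zero
    0≢1 ()

  -- Following left neighbours strictly decreases positions.
  leftNeighbour-closed⇒empty : (Q : L → Set) → (∀ {h} → Q h → Convex h) →
                               (∀ {h} → Q h → ∃ λ h′ → Q h′ × h′ ≢ h × RightNeighbour h′ h) →
                               ∀ {h x} → Q h → branch x ≡ h → ⊥
  leftNeighbour-closed⇒empty Q convex left {x = x} = descend x (<-wellFounded x)
    where
    descend : ∀ {h} x → Acc _<ᶠ_ x → Q h → branch x ≡ h → ⊥
    descend x (acc smaller) Qh px with left Qh
    ... | h′ , Qh′ , h′≢h , (u , v , pu , pv , u→v) =
      descend u (smaller (left-exit-< (convex Qh) pv (outside pu h′≢h) u→v px)) Qh′ pu

module PathModel {m L a b} (M : Model (path m) L a b) where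
  open Labelling (branch M) public

  convexA : ∀ i → Convex (A M i)
  convexA i = connected⇒convex (connectedA M i)

  convexB : ∀ j → Convex (B M j)
  convexB j = connected⇒convex (connectedB M j)

  A-neighbours : ∀ i j → Neighbours (A M i) (B M j)
  A-neighbours i j with adjacent M i j
  ... | _ , _ , px , py , edge = edge⇒neighbours px py edge

  B-neighbours : ∀ j i → Neighbours (B M j) (A M i)
  B-neighbours j i with adjacent M i j
  ... | x , y , px , py , edge = edge⇒neighbours py px (edge-sym (path m) {x} {y} edge)

path-noK₁₃ : ∀ {m L} → ¬ Model (path m) L 1 3
path-noK₁₃ M = at-most-two-neighbours (convexA zero) (B M) (B-injective M)
                                      (λ j → A≢B M zero j ∘ ≡-sym) (A-neighbours zero)
  where open PathModel M

-- In K₂,₂ every branch set has two neighbours, so each has a left neighbour.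
path-noK₂₂ : ∀ {m L} → ¬ Model (path m) L 2 2
path-noK₂₂ {L = L} M with adjacent M zero zero
... | _ , _ , px , _ = leftNeighbour-closed⇒empty Q convex left (inj₁ (zero , refl)) px
  where
  open PathModel M
  Q : L → Set
  Q h = (∃ λ i → A M i ≡ h) ⊎ (∃ λ j → B M j ≡ h)
  convex : ∀ {h} → Q h → Convex h
  convex (inj₁ (i , refl)) = convexA i
  convex (inj₂ (j , refl)) = convexB j
  left : ∀ {h} → Q h → ∃ λ h′ → Q h′ × h′ ≢ h × RightNeighbour h′ h
  left (inj₁ (i , refl)) with two-neighbours⇒leftNeighbour (convexA i) (B M) (B-injective M)
                                (λ j → A≢B M i j ∘ ≡-sym) (A-neighbours i)
  ... | j , l = B M j , inj₂ (j , refl) , A≢B M i j ∘ ≡-sym , l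
  left (inj₂ (j , refl)) with two-neighbours⇒leftNeighbour (convexB j) (A M) (A-injective M)
                                (λ i → A≢B M i j) (B-neighbours j)
  ... | i , l = A M i , inj₁ (i , refl) , A≢B M i j , l

path-noKab : ∀ {m} → NoKabMinor 1 (path m)
path-noKab zero                _             ()  _  _                    _
path-noKab (suc _)             zero          _   () _                    _
path-noKab (suc zero)          _             _   _  (s≤s 3≤b)            M =
  path-noK₁₃ (shrink M ≤-refl 3≤b)
path-noKab (suc (suc zero))    (suc zero)    _   _  (s≤s (s≤s (s≤s ()))) _
path-noKab (suc (suc (suc _))) (suc zero)    _   _  _                    M =
  path-noK₁₃ (shrink (swapSides M) ≤-refl (s≤s (s≤s (s≤s z≤n))))
path-noKab (suc (suc _))       (suc (suc _)) _   _  _                    M =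
  path-noK₂₂ (shrink M (s≤s (s≤s z≤n)) (s≤s (s≤s z≤n)))

-- Disjoint copies

does-≟ᶠ-sym : ∀ {k} (i j : Fin k) → does (i ≟ᶠ j) ≡ does (j ≟ᶠ i)
does-≟ᶠ-sym i j with i ≟ᶠ j
... | yes i≡j = ≡-sym (dec-true (j ≟ᶠ i) (≡-sym i≡j))
... | no i≢j  = ≡-sym (dec-false (j ≟ᶠ i) (i≢j ∘ ≡-sym))

module Copies (N : ℕ) (G : Graph) where

  copy : Fin (N * n G) → Fin N
  copy z = proj₁ (remQuot {N} (n G) z)

  position : Fin (N * n G) → Fin (n G)
  position z = proj₂ (remQuot {N} (n G) z)

  copies : Graph
  copies = record
    { n      = N * n G
    ; adj    = λ x y → does (copy x ≟ᶠ copy y) ∧ adj G (position x) (position y)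
    ; sym    = λ x y → cong₂ _∧_ (does-≟ᶠ-sym (copy x) (copy y))
                                 (Graph.sym G (position x) (position y))
    ; irrefl = λ x → trans (cong (does (copy x ≟ᶠ copy x) ∧_) (irrefl G (position x))) (∧-zeroʳ _)
    }

  copies-edge : ∀ {x y} → Edge copies x y → copy x ≡ copy y × Edge G (position x) (position y)
  copies-edge {x} {y} edge with copy x ≟ᶠ copy y
  copies-edge edge | yes same = same , edge
  copies-edge ()   | no _

  edge⇒same-copy : ∀ {x y} → Edge copies x y → copy x ≡ copy y
  edge⇒same-copy = proj₁ ∘ copies-edge

  walk⇒same-copy : ∀ {P x y} → Star (InducedEdge copies P) x y → copy x ≡ copy y
  walk⇒same-copy ε                       = refl
  walk⇒same-copy ((_ , _ , edge) ◅ walk) = trans (edge⇒same-copy edge) (walk⇒same-copy walk)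

  copy-combine : ∀ i u → copy (combine i u) ≡ i
  copy-combine i u = cong proj₁ (remQuot-combine {N} {n G} i u)

  position-combine : ∀ i u → position (combine i u) ≡ u
  position-combine i u = cong proj₂ (remQuot-combine {N} {n G} i u)

  combine-edge : ∀ i {u v} → Edge G u v → Edge copies (combine i u) (combine i v)
  combine-edge i {u} {v} edge = cong₂ _∧_
    (dec-true (copy (combine i u) ≟ᶠ copy (combine i v))
              (trans (copy-combine i u) (≡-sym (copy-combine i v))))
    (subst₂ (Edge G) (≡-sym (position-combine i u)) (≡-sym (position-combine i v)) edge)

  combine-edge⁻¹ : ∀ i {u v} → Edge copies (combine i u) (combine i v) → Edge G u v
  combine-edge⁻¹ i {u} {v} edge =
    subst₂ (Edge G) (position-combine i u) (position-combine i v) (proj₂ (copies-edge edge))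

  -- K_{a,b} is connected, so all branch sets lie in the copy of any one branch vertex.
  one-copy : ∀ {L a b} → Model copies L (suc a) (suc b) → Model G L (suc a) (suc b)
  one-copy M with adjacent M zero zero
  ... | x₀ , _ , px₀ , _ =
    pullback (combine i₀) (combine-injectiveʳ i₀ _ i₀ _) (combine-edge⁻¹ i₀) M cover
    where
    i₀ : Fin N
    i₀ = copy x₀
    inB : ∀ {j z} → branch M z ≡ B M j → copy z ≡ i₀
    inB {j} {z} pz with adjacent M zero j
    ... | x , y , px , py , edge =
      trans (walk⇒same-copy (connectedB M j z y pz py))
            (trans (≡-sym (edge⇒same-copy edge)) (walk⇒same-copy (connectedA M zero x x₀ px px₀)))
    inA : ∀ {i z} → branch M z ≡ A M i → copy z ≡ i₀
    inA {i} {z} pz with adjacent M i zero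
    ... | x , y , px , py , edge =
      trans (walk⇒same-copy (connectedA M i z x pz px)) (trans (edge⇒same-copy edge) (inB py))
    same-copy : ∀ {z} → InBranchSet M z → copy z ≡ i₀
    same-copy (inj₁ (_ , pz)) = inA pz
    same-copy (inj₂ (_ , pz)) = inB pz
    cover : ∀ z → InBranchSet M z → ∃ λ u → combine i₀ u ≡ z
    cover z inside = position z , subst (λ i → combine i (position z) ≡ z) (same-copy inside)
                                         (combine-remQuot {N} (n G) z)

open Copies using (copies)

copies-noKab : ∀ {r N G} → NoKabMinor (suc r) G → NoKabMinor (suc r) (copies N G)
copies-noKab {N = N} {G} noG (suc a) (suc b) r<a r<b sum M =
  noG (suc a) (suc b) r<a r<b sum (Copies.one-copy N G M)

-- Cones

cone : Graph → Graph
cone G = record { n = suc (n G) ; adj = adj′ ; sym = sym′ ; irrefl = irrefl′ }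
  where
  adj′ : Fin (suc (n G)) → Fin (suc (n G)) → Bool
  adj′ zero    zero    = false
  adj′ zero    (suc _) = true
  adj′ (suc _) zero    = true
  adj′ (suc x) (suc y) = adj G x y
  sym′ : ∀ x y → adj′ x y ≡ adj′ y x
  sym′ zero    zero    = refl
  sym′ zero    (suc _) = refl
  sym′ (suc _) zero    = refl
  sym′ (suc x) (suc y) = Graph.sym G x y
  irrefl′ : ∀ x → adj′ x x ≡ false
  irrefl′ zero    = refl
  irrefl′ (suc x) = irrefl G x

apex-free : ∀ {G L a b} (M : Model (cone G) L a b) →
            (∀ i → branch M zero ≢ A M i) → (∀ j → branch M zero ≢ B M j) → Model G L a b
apex-free M apex∉A apex∉B = pullback suc suc-injective id M cover
  where
  cover : ∀ z → InBranchSet M z → ∃ λ w → suc w ≡ z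
  cover zero    (inj₁ (i , p)) = ⊥-elim (apex∉A i p)
  cover zero    (inj₂ (j , p)) = ⊥-elim (apex∉B j p)
  cover (suc w) _              = w , refl

apex-in-A : ∀ {G L a b} (M : Model (cone G) L (suc a) b) i → branch M zero ≡ A M i → Model G L a b
apex-in-A M i apex∈Ai =
  apex-free (restrict M (punchIn i) (punchIn-injective i _ _) id id)
    (λ k p → punchInᵢ≢i i k (A-injective M (trans (≡-sym p) apex∈Ai)))
    (λ j p → A≢B M i j (trans (≡-sym apex∈Ai) p))

cone-noKab : ∀ {r G} → NoKabMinor r G → NoKabMinor (suc r) (cone G)
cone-noKab {r} noG (suc a) (suc b) (s≤s r≤a) (s≤s r≤b) r+3<a+b M =
  noG (suc a) (suc b) (m≤n⇒m≤1+n r≤a) (m≤n⇒m≤1+n r≤b) (<⇒≤ r+3<a+b) (apex-free M apex∉A apex∉B)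
  where
  r+3≤a+b′ : r + 3 ≤ a + suc b
  r+3≤a+b′ = s≤s⁻¹ r+3<a+b
  apex∉A : ∀ i → branch M zero ≢ A M i
  apex∉A i p = noG a (suc b) r≤a (m≤n⇒m≤1+n r≤b) r+3≤a+b′ (apex-in-A M i p)
  apex∉B : ∀ j → branch M zero ≢ B M j
  apex∉B j p = noG b (suc a) r≤b (m≤n⇒m≤1+n r≤a)
    (≤-trans r+3≤a+b′ (≤-reflexive (trans (+-comm a (suc b)) (≡-sym (+-suc b a)))))
    (apex-in-A (swapSides M) j p)

-- Monochromatic components

mono-map : ∀ {G H k l c} (e : Fin (n G) → Fin (n H)) → Injective _≡_ _≡_ e →
           (∀ {u v} → Edge G u v → Edge H (e u) (e v)) →
           (f : Colouring H k) (g : Colouring G l) → (∀ {u v} → g u ≡ g v → f (e u) ≡ f (e v)) →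
           HasMonoComponentLargerThan G g c → HasMonoComponentLargerThan H f c
mono-map {G} {H} e e-inj e-edge f g colours (v , w , w-inj , component) =
  e v , e ∘ w , w-inj ∘ e-inj , transport ∘ component
  where
  transport : ∀ {u} → InMonoComponent G g v u → InMonoComponent H f (e v) (e u)
  transport (_ , gu , walk) =
    refl , colours gu , gmap e (λ (p , q , edge) → colours p , colours q , e-edge edge) walk

path-mono : ∀ {c} (f : Colouring (path (suc c)) 1) → HasMonoComponentLargerThan (path (suc c)) f c
path-mono f = zero , id , id , λ x → refl , one-colour x , path-connected _ one-colour x
  where
  one-colour : ∀ z → f z ≡ f zero
  one-colour z with f z | f zero
  ... | zero | zero = refl

cone-star : ∀ {G k c} (f : Colouring (cone G) k) (w : Fin c → Fin (n G)) → Injective _≡_ _≡_ w →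
            (∀ i → f (suc (w i)) ≡ f zero) → HasMonoComponentLargerThan (cone G) f c
cone-star {G} {c = c} f w w-inj apex-colour = zero , star , star-inj , member
  where
  star : Fin (suc c) → Fin (suc (n G))
  star zero    = zero
  star (suc i) = suc (w i)
  star-inj : Injective _≡_ _≡_ star
  star-inj {zero}  {zero}  _  = refl
  star-inj {suc i} {suc j} eq = cong suc (w-inj (suc-injective eq))
  star-inj {zero}  {suc _} ()
  star-inj {suc _} {zero}  ()
  member : ∀ i → InMonoComponent (cone G) f zero (star i)
  member zero    = refl , refl , ε
  member (suc i) = refl , apex-colour i , (refl , apex-colour i , refl) ◅ ε

copy-avoiding-apex-colour :
  ∀ {N G k c} → (∀ (g : Colouring G k) → HasMonoComponentLargerThan G g c) →
  (f : Colouring (cone (copies N G)) (suc k)) (i : Fin N) →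
  (∀ u → f (suc (combine i u)) ≢ f zero) → HasMonoComponentLargerThan (cone (copies N G)) f c
copy-avoiding-apex-colour {N} {G} {k} mono f i avoids =
  mono-map {G = G} {H = cone (copies N G)} (suc ∘ combine i)
           (λ eq → combine-injectiveʳ i _ i _ (suc-injective eq)) (Copies.combine-edge N G i)
           f recoloured (punchOut-injective {i = f zero} _ _) (mono recoloured)
  where
  recoloured : Colouring G k
  recoloured u = punchOut (avoids u ∘ ≡-sym)

cone-copies-mono : ∀ {G k c} → (∀ (g : Colouring G k) → HasMonoComponentLargerThan G g c) →
                   ∀ (f : Colouring (cone (copies c G)) (suc k)) →
                   HasMonoComponentLargerThan (cone (copies c G)) f c
cone-copies-mono {G} {k} {c} mono f = by-cases (all? apex-colour-in?)
  where
  apex-colour-in? : ∀ i → Dec (∃ λ u → f (suc (combine i u)) ≡ f zero)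
  apex-colour-in? i = any? (λ u → f (suc (combine i u)) ≟ᶠ f zero)
  by-cases : Dec (∀ i → ∃ λ u → f (suc (combine i u)) ≡ f zero) →
             HasMonoComponentLargerThan (cone (copies c G)) f c
  by-cases (yes everywhere) =
    cone-star f (λ i → combine i (proj₁ (everywhere i))) (combine-injectiveˡ _ _ _ _)
              (proj₂ ∘ everywhere)
  by-cases (no missing) with ¬∀⟶∃¬ c _ apex-colour-in? missing
  ... | i , avoids = copy-avoiding-apex-colour {G = G} mono f i (λ u p → avoids (u , p))

graph : ℕ → ℕ → Graph
graph c zero    = path (suc c)
graph c (suc k) = cone (copies c (graph c k))

graph-noKab : ∀ c k → NoKabMinor (suc k) (graph c k)
graph-noKab c zero    = path-noKab
graph-noKab c (suc k) = cone-noKab (copies-noKab {N = c} {G = graph c k} (graph-noKab c k))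

graph-mono : ∀ c k (f : Colouring (graph c k) (suc k)) → HasMonoComponentLargerThan (graph c k) f c
graph-mono c zero    = path-mono
graph-mono c (suc k) = cone-copies-mono {G = graph c k} (graph-mono c k)

-- The construction works for every c.
proposition18 : ∀ (s t c : ℕ) → 1 ≤ s → s ≤ t → 3 ≤ t → 1 ≤ c →
    Σ Graph λ G → ¬ HasKstMinor G s t ×
    (∀ (f : Colouring G s) → HasMonoComponentLargerThan G f c)
proposition18 zero    _ _ ()  _   _   _
proposition18 (suc k) t c _   s≤t 3≤t _ =
  graph c k ,
  (λ M → graph-noKab c k (suc k) t ≤-refl s≤t (+-monoʳ-≤ (suc k) 3≤t) (fromKstMinorModel M)) ,
  graph-mono c k
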